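{- Let $n$ be a positive integer, $G:=\mathcal{W}^*(K_n)$, and $\mathbf{x}\in\mathbb{Z}^{2n+1}$. Then $\frac{1}{2n+1}\mathbf{x}\in\Lambda(\mathcal{P}_G)$ if and only if all of the following hold: (1) $0\le x_i\le 2n$ for all $i\in[2n+1]$; (2) for each $n+1\le i\le 2n$ there exists $k_i\in\mathbb{Z}$ such that $x_i=(n+1)x_{i-n}-\sum_{j=1}^n x_j-(2n+1)k_i$; (3) for each $j\in[n]$ there exists $m_j\in\mathbb{Z}$ such that $x_{2n+1}=2x_{j+n}-x_j-(2n+1)m_j$.
   Context: $K_n$ is the complete graph on $[n]$; $\mathcal{W}^*(K_n)$ is the graph on $[2n+1]$ whose edges are those of $K_n$, the edges $\{i,i+n\}$ for $i\in[n]$, and the edges $\{i,2n+1\}$ for $n+1\le i\le 2n$. The Laplacian matrix $L$ of a simple graph on $[m]$ has $L_{ii}=\deg(i)$, $L_{ij}=-1$ if $\{i,j\}$ is an edge and $0$ otherwise; the Laplacian simplex $\mathcal{P}_G$ is the convex hull in $\mathbb{R}^{m-1}$ of the rows $\mathbf{v}_1,\dots,\mathbf{v}_m$ (in order) of $L$ with its $m$-th column deleted. $\Lambda(\mathcal{P}_G)$ is the set of $\lambda\in[0,1)^m$ with $\sum_i\lambda_i(\mathbf{v}_i,1)\in\mathbb{Z}^m$. -}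

module Defs where

open import Data.Nat as ℕ using (ℕ; zero; suc; _≤ᵇ_; _≡ᵇ_)
open import Data.Bool using (Bool; true; false; _∧_; _∨_; not; if_then_else_)
open import Data.Fin as Fin using (Fin; toℕ; inject₁; fromℕ; fromℕ<)
open import Data.Integer as ℤ using (ℤ; +_)
open import Data.Rational as ℚ using (ℚ; 0ℚ; 1ℚ)
open import Data.Product using (Σ; _×_)
open import Relation.Binary.PropositionalEquality using (_≡_)
open import Relation.Nullary using (yes; no)

-- A simple graph on the vertex set [m], vertex i ∈ [m] represented by Fin m
-- index i-1; given by its (symmetric, irreflexive) adjacency function.
Graph : ℕ → Set
Graph m = Fin m → Fin m → Bool

sumℤ : ∀ {m} → (Fin m → ℤ) → ℤ
sumℤ {zero} f = + 0
sumℤ {suc m} f = f Fin.zero ℤ.+ sumℤ (λ i → f (Fin.suc i))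

sumℚ : ∀ {m} → (Fin m → ℚ) → ℚ
sumℚ {zero} f = 0ℚ
sumℚ {suc m} f = f Fin.zero ℚ.+ sumℚ (λ i → f (Fin.suc i))

boolℤ : Bool → ℤ
boolℤ true = + 1
boolℤ false = + 0

degree : ∀ {m} → Graph m → Fin m → ℤ
degree G i = sumℤ (λ j → boolℤ (G i j))

laplacian : ∀ {m} → Graph m → Fin m → Fin m → ℤ
laplacian G i j with i Fin.≟ j
... | yes _ = degree G i
... | no _ = ℤ.- boolℤ (G i j)

-- Vertex v_i of the Laplacian simplex (row i of L with the last column deleted),
-- for a graph on m = suc k vertices; coordinates indexed by Fin k.
lapVertex : ∀ {k} → Graph (suc k) → Fin (suc k) → Fin k → ℤ
lapVertex G i c = laplacian G i (inject₁ c)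

liftVertex : ∀ {k} → Graph (suc k) → Fin (suc k) → Fin (suc k) → ℤ
liftVertex {k} G i c with Fin.toℕ c ℕ.<? k
... | yes c<k = lapVertex G i (fromℕ< c<k)
... | no _ = + 1

IsInteger : ℚ → Set
IsInteger q = Σ ℤ (λ z → q ≡ z ℚ./ 1)

InΛ : ∀ {k} → Graph (suc k) → (Fin (suc k) → ℚ) → Set
InΛ {k} G lam =
  ((i : Fin (suc k)) → (0ℚ ℚ.≤ lam i) × (lam i ℚ.< 1ℚ)) ×
  ((c : Fin (suc k)) →
     IsInteger (sumℚ (λ i → lam i ℚ.* (liftVertex G i c ℚ./ 1))))

-- W*(K_n) on [2n+1], with 1-based vertex labels a, b:
-- edges of K_n, {i, i+n} for i ∈ [n], {i, 2n+1} for n+1 ≤ i ≤ 2n.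
edgeW1 : ℕ → ℕ → ℕ → Bool
edgeW1 n a b =
  ((1 ≤ᵇ a) ∧ (a ≤ᵇ n) ∧ (1 ≤ᵇ b) ∧ (b ≤ᵇ n) ∧ not (a ≡ᵇ b))
  ∨ ((1 ≤ᵇ a) ∧ (a ≤ᵇ n) ∧ (b ≡ᵇ (a ℕ.+ n)))
  ∨ ((suc n ≤ᵇ a) ∧ (a ≤ᵇ (n ℕ.+ n)) ∧ (b ≡ᵇ suc (n ℕ.+ n)))

edgeW : ℕ → ℕ → ℕ → Bool
edgeW n a b = edgeW1 n a b ∨ edgeW1 n b a

WStarK : (n : ℕ) → Graph (suc (2 ℕ.* n))
WStarK n i j = edgeW n (suc (toℕ i)) (suc (toℕ j))

-- 1-based access x_a to a vector x ∈ ℤ^m (value 0 outside [m]; only used in range)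
at : ∀ {m} → (Fin m → ℤ) → ℕ → ℤ
at {m} x zero = + 0
at {m} x (suc a) with a ℕ.<? m
... | yes a<m = x (fromℕ< a<m)
... | no _ = + 0

sumTo : ∀ {m} → (Fin m → ℤ) → ℕ → ℤ
sumTo x zero = + 0
sumTo x (suc j) = sumTo x j ℤ.+ at x (suc j)

-- λ = x/(2n+1) lies in Λ(P_G) iff 0 ≤ xᵢ ≤ 2n and 2n+1 divides every coordinate of
-- Σᵢ xᵢ (vᵢ,1). As the Laplacian L is symmetric, the coordinate c ≤ 2n is
-- (Lx)_c = Σ_{i∼c} (x_c − xᵢ): at a vertex q of K_n it is (n+1) x_q − Σ_{j≤n} x_j − x_{q+n}, and at
-- the vertex q+n it is 2 x_{q+n} − x_q − x_{2n+1}; these are conditions (2) and (3). The last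
-- coordinate imposes nothing new, since
--   Σᵢ xᵢ = 3 Σ_{q≤n} (Lx)_q + 2 Σ_{q≤n} (Lx)_{q+n} + (2n+1) x_{2n+1}.

module Submission where

open import Defs
open import Data.Nat as ℕ using (ℕ; zero; suc; _<_; _≤_; z≤n; s≤s; _≡ᵇ_)
import Data.Nat.Properties as ℕP
open import Data.Fin as Fin using (Fin; toℕ; fromℕ<; inject₁; punchIn)
import Data.Fin.Properties as FinP
open import Data.Integer as ℤ using (ℤ; +_; 0ℤ; _+_; _*_; _-_; -_)
import Data.Integer.Properties as ℤP
open import Data.Integer.Divisibility.Signed
  using (_∣_; divides; ∣-refl; ∣m∣n⇒∣m+n; ∣n⇒∣m*n; ∣m⇒∣m*n)
open import Data.Integer.Tactic.RingSolver using (solve-∀)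
open import Data.Rational as ℚ using (0ℚ; 1ℚ; toℚᵘ)
import Data.Rational.Properties as ℚP
open import Data.Rational.Unnormalised as ℚᵘ using (mkℚᵘ; *≡*; *≤*; *<*)
import Data.Rational.Unnormalised.Properties as ℚᵘP
open import Data.Bool using (false)
import Data.Bool.Properties as BoolP
open import Data.Product using (Σ; _×_; _,_; proj₁; proj₂)
open import Data.Product.Function.NonDependent.Propositional using (_×-⇔_)
open import Data.Sum using (_⊎_; inj₁; inj₂; [_,_])
open import Algebra.Properties.Semiring.Sum ℤP.+-*-semiring
  using (sum; sum-cong-≗; sum-remove; sum-replicate-zero; ∑-distrib-+; *-distribˡ-sum)
open import Function using (_∘_)
open import Function.Bundles using (_⇔_; mk⇔; Equivalence)
open import Function.Construct.Composition using (_⇔-∘_)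
open import Relation.Binary.PropositionalEquality
  using (_≡_; _≢_; refl; sym; trans; cong; cong₂; subst; subst₂; module ≡-Reasoning)
open import Relation.Nullary using (¬_; Dec; yes; no; contradiction)
open import Relation.Nullary.Reflects
  using (Reflects; ofʸ; ofⁿ; fromEquivalence; det; ¬-reflects; _×-reflects_; _⊎-reflects_)

Π-⇔ : {A : Set} {P Q : A → Set} → (∀ a → P a ⇔ Q a) → ((a : A) → P a) ⇔ ((a : A) → Q a)
Π-⇔ P⇔Q = mk⇔ (λ f a → Equivalence.to (P⇔Q a) (f a)) (λ g a → Equivalence.from (P⇔Q a) (g a))

-- Sums and identities in ℤ

sumℤ≡sum : ∀ {m} (f : Fin m → ℤ) → sumℤ f ≡ sum f
sumℤ≡sum {zero} f = refl
sumℤ≡sum {suc m} f = cong (_+_ (f Fin.zero)) (sumℤ≡sum (f ∘ Fin.suc))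

sum-single : ∀ {m} (f : Fin m → ℤ) c → (∀ i → i ≢ c → f i ≡ 0ℤ) → sum f ≡ f c
sum-single {suc m} f c vanish = begin
  sum f                          ≡⟨ sum-remove {i = c} f ⟩
  f c + sum (f ∘ punchIn c)      ≡⟨ cong (_+_ (f c)) rest≡0 ⟩
  f c + 0ℤ                       ≡⟨ ℤP.+-identityʳ (f c) ⟩
  f c                            ∎
  where
  open ≡-Reasoning
  rest≡0 : sum (f ∘ punchIn c) ≡ 0ℤ
  rest≡0 = trans (sum-cong-≗ (λ j → vanish (punchIn c j) (FinP.punchInᵢ≢i c j)))
                 (sum-replicate-zero m)

∑< : ℕ → (ℕ → ℤ) → ℤ
∑< k f = sum {k} (f ∘ toℕ)

syntax ∑< k (λ p → e) = ∑[ p < k ] e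

∑<-cong : ∀ k {f g : ℕ → ℤ} → (∀ p → p < k → f p ≡ g p) → ∑< k f ≡ ∑< k g
∑<-cong k f≡g = sum-cong-≗ (λ i → f≡g (toℕ i) (FinP.toℕ<n i))

∑<-snoc : ∀ k (f : ℕ → ℤ) → ∑< (suc k) f ≡ ∑< k f + f k
∑<-snoc zero f = trans (ℤP.+-identityʳ (f 0)) (sym (ℤP.+-identityˡ (f 0)))
∑<-snoc (suc k) f = trans (cong (_+_ (f 0)) (∑<-snoc k (f ∘ suc)))
                          (sym (ℤP.+-assoc (f 0) (∑< k (f ∘ suc)) (f (suc k))))

∑<-+ : ∀ a b (f : ℕ → ℤ) → ∑< (a ℕ.+ b) f ≡ ∑< a f + ∑[ p < b ] f (a ℕ.+ p)
∑<-+ zero b f = sym (ℤP.+-identityˡ (∑< b f))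
∑<-+ (suc a) b f = trans (cong (_+_ (f 0)) (∑<-+ a b (f ∘ suc)))
                         (sym (ℤP.+-assoc (f 0) (∑< a (f ∘ suc)) (∑[ p < b ] f (suc a ℕ.+ p))))

∑<-single : ∀ k {f : ℕ → ℤ} q → q < k → (∀ p → p < k → p ≢ q → f p ≡ 0ℤ) → ∑< k f ≡ f q
∑<-single k {f} q q<k vanish =
  trans (sum-single (f ∘ toℕ) c (λ i i≢c → vanish (toℕ i) (FinP.toℕ<n i) (i≢c ∘ toℕ≡q⇒≡c)))
        (cong f (FinP.toℕ-fromℕ< q<k))
  where
  c = fromℕ< q<k
  toℕ≡q⇒≡c : ∀ {i} → toℕ i ≡ q → i ≡ c
  toℕ≡q⇒≡c e = FinP.toℕ-injective (trans e (sym (FinP.toℕ-fromℕ< q<k)))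

∑<-zero : ∀ k {f : ℕ → ℤ} → (∀ p → p < k → f p ≡ 0ℤ) → ∑< k f ≡ 0ℤ
∑<-zero k vanish = trans (∑<-cong k vanish) (sum-replicate-zero k)

∑<-affine : ∀ k a b c (f g : ℕ → ℤ) →
  ∑[ p < k ] (a * f p + b * g p + c) ≡ a * ∑< k f + b * ∑< k g + + k * c
∑<-affine zero a b c f g = empty a b c
  where
  empty : ∀ a b c → 0ℤ ≡ a * 0ℤ + b * 0ℤ + 0ℤ * c
  empty = solve-∀
∑<-affine (suc k) a b c f g =
  trans (cong (_+_ (a * f 0 + b * g 0 + c)) (∑<-affine k a b c (f ∘ suc) (g ∘ suc)))
        (step a b c (f 0) (g 0) (∑< k (f ∘ suc)) (∑< k (g ∘ suc)) (+ k))
  where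
  step : ∀ a b c f₀ g₀ F G K →
    a * f₀ + b * g₀ + c + (a * F + b * G + K * c) ≡ a * (f₀ + F) + b * (g₀ + G) + (+ 1 + K) * c
  step = solve-∀

∑<-const-sub : ∀ k c (f : ℕ → ℤ) → ∑[ p < k ] (c - f p) ≡ + k * c - ∑< k f
∑<-const-sub zero c f = empty c
  where
  empty : ∀ c → 0ℤ ≡ 0ℤ * c - 0ℤ
  empty = solve-∀
∑<-const-sub (suc k) c f =
  trans (cong (_+_ (c - f 0)) (∑<-const-sub k c (f ∘ suc)))
        (step c (f 0) (∑< k (f ∘ suc)) (+ k))
  where
  step : ∀ c f₀ F K → c - f₀ + (K * c - F) ≡ (+ 1 + K) * c - (f₀ + F)
  step = solve-∀

∑<-∣ : ∀ k {d} {f : ℕ → ℤ} → (∀ p → p < k → d ∣ f p) → d ∣ ∑< k f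
∑<-∣ zero _ = divides 0ℤ refl
∑<-∣ (suc k) d∣f = ∣m∣n⇒∣m+n (d∣f 0 ℕ.z<s) (∑<-∣ k (λ p p<k → d∣f (suc p) (s≤s p<k)))

weight-one : ∀ w {a} → a ≡ + 1 → w * a ≡ w
weight-one w a≡1 = trans (cong (w *_) a≡1) (ℤP.*-identityʳ w)

weight-zero : ∀ w {a} → a ≡ 0ℤ → w * a ≡ 0ℤ
weight-zero w a≡0 = trans (cong (w *_) a≡0) (ℤP.*-zeroʳ w)

∣-sub⇔ : ∀ d a y → d ∣ a - y ⇔ Σ ℤ (λ k → y ≡ a - d * k)
∣-sub⇔ d a y = mk⇔ to from
  where
  to : d ∣ a - y → Σ ℤ (λ k → y ≡ a - d * k)
  to (divides k a-y≡k*d) =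
    k , trans (double-sub a y) (cong (λ w → a - w) (trans a-y≡k*d (ℤP.*-comm k d)))
    where
    double-sub : ∀ a y → y ≡ a - (a - y)
    double-sub = solve-∀
  from : Σ ℤ (λ k → y ≡ a - d * k) → d ∣ a - y
  from (k , y≡a-d*k) =
    divides k (trans (cong (λ w → a - w) y≡a-d*k) (double-sub a d k))
    where
    double-sub : ∀ a d k → a - (a - d * k) ≡ k * d
    double-sub = solve-∀

-- Laplacians of simple graphs

laplacian-diagonal : ∀ {m} (G : Graph m) i → laplacian G i i ≡ degree G i
laplacian-diagonal G i with i Fin.≟ i
... | yes _ = refl
... | no i≢i = contradiction refl i≢i

laplacian-offDiagonal : ∀ {m} (G : Graph m) {i j} → i ≢ j → laplacian G i j ≡ - boolℤ (G i j)
laplacian-offDiagonal G {i} {j} i≢j with i Fin.≟ j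
... | yes i≡j = contradiction i≡j i≢j
... | no _ = refl

x*laplacian-sum : ∀ {m} (G : Graph m) → (∀ i → G i i ≡ false) → (x : Fin m → ℤ) → ∀ c →
  sum (λ i → x i * laplacian G i c) ≡ x c * degree G c + sum (λ i → - (x i * boolℤ (G i c)))
x*laplacian-sum G G-irrefl x c = begin
  sum (λ i → x i * laplacian G i c)   ≡⟨ sum-cong-≗ (λ i → split (x i * laplacian G i c) (x i * a i)) ⟩
  sum (λ i → d i + - (x i * a i))     ≡⟨ ∑-distrib-+ d (λ i → - (x i * a i)) ⟩
  sum d + rest                        ≡⟨ cong (λ s → s + rest) (sum-single d c d-offDiagonal) ⟩
  d c + rest                          ≡⟨ cong (λ s → s + rest) d-diagonal ⟩
  x c * degree G c + rest             ∎
  where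
  open ≡-Reasoning
  a : Fin _ → ℤ
  a i = boolℤ (G i c)
  rest = sum (λ i → - (x i * a i))
  d : Fin _ → ℤ
  d i = x i * laplacian G i c + x i * a i
  d-offDiagonal : ∀ i → i ≢ c → d i ≡ 0ℤ
  d-offDiagonal i i≢c rewrite laplacian-offDiagonal G i≢c =
    trans (cong (λ y → y + x i * a i) (sym (ℤP.neg-distribʳ-* (x i) (a i)))) (ℤP.+-inverseˡ (x i * a i))
  d-diagonal : d c ≡ x c * degree G c
  d-diagonal rewrite laplacian-diagonal G c | G-irrefl c =
    trans (cong (_+_ (x c * degree G c)) (ℤP.*-zeroʳ (x c))) (ℤP.+-identityʳ _)
  split : ∀ u v → u ≡ (u + v) + - v
  split = solve-∀

differences*adjacency-sum : ∀ {m} (G : Graph m) → (∀ i j → G i j ≡ G j i) → (x : Fin m → ℤ) → ∀ c →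
  sum (λ i → (x c - x i) * boolℤ (G i c)) ≡ x c * degree G c + sum (λ i → - (x i * boolℤ (G i c)))
differences*adjacency-sum G G-sym x c = begin
  sum (λ i → (x c - x i) * a i)         ≡⟨ sum-cong-≗ (λ i → distrib (x c) (x i) (a i)) ⟩
  sum (λ i → x c * a i + - (x i * a i)) ≡⟨ ∑-distrib-+ (λ i → x c * a i) (λ i → - (x i * a i)) ⟩
  sum (λ i → x c * a i) + rest          ≡⟨ cong (λ s → s + rest) (sym (*-distribˡ-sum (x c) a)) ⟩
  x c * sum a + rest                    ≡⟨ cong (λ s → x c * s + rest) a-sum ⟩
  x c * degree G c + rest               ∎
  where
  open ≡-Reasoning
  a : Fin _ → ℤ
  a i = boolℤ (G i c)
  rest = sum (λ i → - (x i * a i))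
  a-sum : sum a ≡ degree G c
  a-sum = trans (sum-cong-≗ (λ i → cong boolℤ (G-sym i c))) (sym (sumℤ≡sum (λ j → boolℤ (G c j))))
  distrib : ∀ u v w → (u - v) * w ≡ u * w + - (v * w)
  distrib = solve-∀

laplacian-action : ∀ {m} (G : Graph m) → (∀ i j → G i j ≡ G j i) → (∀ i → G i i ≡ false) →
  (x : Fin m → ℤ) → ∀ c →
  sum (λ i → x i * laplacian G i c) ≡ sum (λ i → (x c - x i) * boolℤ (G i c))
laplacian-action G G-sym G-irrefl x c =
  trans (x*laplacian-sum G G-irrefl x c) (sym (differences*adjacency-sum G G-sym x c))

at-suc-toℕ : ∀ {m} (x : Fin m → ℤ) i → at x (suc (toℕ i)) ≡ x i
at-suc-toℕ {m} x i with toℕ i ℕ.<? m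
... | yes i<m = cong x (FinP.fromℕ<-toℕ i i<m)
... | no i≮m = contradiction (FinP.toℕ<n i) i≮m

sumTo≡∑< : ∀ {m} (x : Fin m → ℤ) j → sumTo x j ≡ ∑[ p < j ] at x (suc p)
sumTo≡∑< x zero = refl
sumTo≡∑< x (suc j) = trans (cong (λ s → s + at x (suc j)) (sumTo≡∑< x j)) (sym (∑<-snoc j (λ p → at x (suc p))))

liftVertex-inner : ∀ {k} (G : Graph (suc k)) i c (c<k : toℕ c < k) →
  liftVertex G i c ≡ laplacian G i (inject₁ (fromℕ< c<k))
liftVertex-inner {k} G i c c<k with toℕ c ℕ.<? k
... | yes _ = refl
... | no c≮k = contradiction c<k c≮k

liftVertex-last : ∀ {k} (G : Graph (suc k)) i c → ¬ toℕ c < k → liftVertex G i c ≡ + 1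
liftVertex-last {k} G i c c≮k with toℕ c ℕ.<? k
... | yes c<k = contradiction c<k c≮k
... | no _ = refl

-- Fractions with denominator d + 1

toℚᵘ-/ : ∀ w d → toℚᵘ (w ℚ./ suc d) ℚᵘ.≃ mkℚᵘ w d
toℚᵘ-/ w d = ℚP.toℚᵘ-fromℚᵘ (mkℚᵘ w d)

/-*-/1 : ∀ a b d → (a ℚ./ suc d) ℚ.* (b ℚ./ 1) ≡ (a * b) ℚ./ suc d
/-*-/1 a b d = ℚP.toℚᵘ-injective (begin
  toℚᵘ ((a ℚ./ suc d) ℚ.* (b ℚ./ 1))       ≈⟨ ℚP.toℚᵘ-homo-* (a ℚ./ suc d) (b ℚ./ 1) ⟩
  toℚᵘ (a ℚ./ suc d) ℚᵘ.* toℚᵘ (b ℚ./ 1)  ≈⟨ ℚᵘP.*-cong (toℚᵘ-/ a d) (toℚᵘ-/ b 0) ⟩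
  mkℚᵘ a d ℚᵘ.* mkℚᵘ b 0                  ≈⟨ *≡* (cong (λ k → a * b * + suc k) (sym (ℕP.*-identityʳ d))) ⟩
  mkℚᵘ (a * b) d                          ≈⟨ toℚᵘ-/ (a * b) d ⟨
  toℚᵘ ((a * b) ℚ./ suc d)                ∎)
  where open ℚᵘP.≃-Reasoning

/-+-/ : ∀ a b d → (a ℚ./ suc d) ℚ.+ (b ℚ./ suc d) ≡ (a + b) ℚ./ suc d
/-+-/ a b d = ℚP.toℚᵘ-injective (begin
  toℚᵘ ((a ℚ./ suc d) ℚ.+ (b ℚ./ suc d))       ≈⟨ ℚP.toℚᵘ-homo-+ (a ℚ./ suc d) (b ℚ./ suc d) ⟩
  toℚᵘ (a ℚ./ suc d) ℚᵘ.+ toℚᵘ (b ℚ./ suc d)  ≈⟨ ℚᵘP.+-cong (toℚᵘ-/ a d) (toℚᵘ-/ b d) ⟩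
  mkℚᵘ a d ℚᵘ.+ mkℚᵘ b d                      ≈⟨ *≡* (common-denominator a b (+ suc d)) ⟩
  mkℚᵘ (a + b) d                              ≈⟨ toℚᵘ-/ (a + b) d ⟨
  toℚᵘ ((a + b) ℚ./ suc d)                    ∎)
  where
  open ℚᵘP.≃-Reasoning
  common-denominator : ∀ a b N → (a * N + b * N) * N ≡ (a + b) * (N * N)
  common-denominator = solve-∀

sumℚ-/ : ∀ {m} d (a b : Fin m → ℤ) →
  sumℚ (λ i → (a i ℚ./ suc d) ℚ.* (b i ℚ./ 1)) ≡ sumℤ (λ i → a i * b i) ℚ./ suc d
sumℚ-/ {zero} d a b = sym (ℚP.0/n≡0 (suc d))
sumℚ-/ {suc m} d a b = trans
  (cong₂ ℚ._+_ (/-*-/1 (a Fin.zero) (b Fin.zero) d) (sumℚ-/ d (a ∘ Fin.suc) (b ∘ Fin.suc)))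
  (/-+-/ (a Fin.zero * b Fin.zero) (sumℤ (λ i → a (Fin.suc i) * b (Fin.suc i))) d)

isInteger-/⇔∣ : ∀ w d → IsInteger (w ℚ./ suc d) ⇔ + suc d ∣ w
isInteger-/⇔∣ w d = mk⇔ to from
  where
  to : IsInteger (w ℚ./ suc d) → + suc d ∣ w
  to (z , w/N≡z) with ℚᵘP.≃-trans (ℚᵘP.≃-sym (toℚᵘ-/ w d)) (ℚᵘP.≃-trans (ℚP.toℚᵘ-cong w/N≡z) (toℚᵘ-/ z 0))
  ... | *≡* w*1≡z*N = divides z (trans (sym (ℤP.*-identityʳ w)) w*1≡z*N)
  from : + suc d ∣ w → IsInteger (w ℚ./ suc d)
  from (divides z w≡z*N) = z , ℚP.toℚᵘ-injective
    (ℚᵘP.≃-trans (toℚᵘ-/ w d)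
      (ℚᵘP.≃-trans (*≡* (trans (ℤP.*-identityʳ w) w≡z*N)) (ℚᵘP.≃-sym (toℚᵘ-/ z 0))))

0≤/⇔ : ∀ w d → 0ℚ ℚ.≤ w ℚ./ suc d ⇔ + 0 ℤ.≤ w
0≤/⇔ w d = mk⇔ to from
  where
  to : 0ℚ ℚ.≤ w ℚ./ suc d → + 0 ℤ.≤ w
  to 0≤w/N with ℚᵘP.≤-respʳ-≃ (toℚᵘ-/ w d) (ℚP.toℚᵘ-mono-≤ 0≤w/N)
  ... | *≤* 0≤w*1 = subst (+ 0 ℤ.≤_) (ℤP.*-identityʳ w) 0≤w*1
  from : + 0 ℤ.≤ w → 0ℚ ℚ.≤ w ℚ./ suc d
  from 0≤w = ℚP.toℚᵘ-cancel-≤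
    (ℚᵘP.≤-respʳ-≃ (ℚᵘP.≃-sym (toℚᵘ-/ w d)) (*≤* (subst (+ 0 ℤ.≤_) (sym (ℤP.*-identityʳ w)) 0≤w)))

/<1⇔ : ∀ w d → w ℚ./ suc d ℚ.< 1ℚ ⇔ w ℤ.≤ + d
/<1⇔ w d = mk⇔ to from
  where
  to : w ℚ./ suc d ℚ.< 1ℚ → w ℤ.≤ + d
  to w/N<1 with ℚᵘP.<-respˡ-≃ (toℚᵘ-/ w d) (ℚP.toℚᵘ-mono-< w/N<1)
  ... | *<* w*1<N = ℤP.i<j⇒i≤pred[j] (subst₂ ℤ._<_ (ℤP.*-identityʳ w) (ℤP.*-identityˡ (+ suc d)) w*1<N)
  from : w ℤ.≤ + d → w ℚ./ suc d ℚ.< 1ℚ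
  from w≤d = ℚP.toℚᵘ-cancel-< (ℚᵘP.<-respˡ-≃ (ℚᵘP.≃-sym (toℚᵘ-/ w d))
    (*<* (subst₂ ℤ._<_ (sym (ℤP.*-identityʳ w)) (sym (ℤP.*-identityˡ (+ suc d)))
           (ℤP.≤-<-trans w≤d (ℤ.+<+ (ℕP.n<1+n d))))))

-- The graph W*(K_n)

≡ᵇ-reflects-≡ : ∀ m n → Reflects (m ≡ n) (m ≡ᵇ n)
≡ᵇ-reflects-≡ m n = fromEquivalence (ℕP.≡ᵇ⇒≡ m n) (ℕP.≡⇒≡ᵇ m n)

Edge : ℕ → ℕ → ℕ → Set
Edge n a b =
  (1 ≤ a × a ≤ n × 1 ≤ b × b ≤ n × a ≢ b)
  ⊎ (1 ≤ a × a ≤ n × b ≡ a ℕ.+ n)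
  ⊎ (suc n ≤ a × a ≤ n ℕ.+ n × b ≡ suc (n ℕ.+ n))

Adjacent : ℕ → ℕ → ℕ → Set
Adjacent n a b = Edge n a b ⊎ Edge n b a

edgeW1-reflects : ∀ n a b → Reflects (Edge n a b) (edgeW1 n a b)
edgeW1-reflects n a b =
  (≤ 1 a ×-reflects ≤ a n ×-reflects ≤ 1 b ×-reflects ≤ b n ×-reflects ¬-reflects (≡ᵇ-reflects-≡ a b))
  ⊎-reflects (≤ 1 a ×-reflects ≤ a n ×-reflects ≡ᵇ-reflects-≡ b (a ℕ.+ n))
  ⊎-reflects (≤ (suc n) a ×-reflects ≤ a (n ℕ.+ n) ×-reflects ≡ᵇ-reflects-≡ b (suc (n ℕ.+ n)))
  where ≤ = ℕP.≤ᵇ-reflects-≤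

edgeW-reflects : ∀ n a b → Reflects (Adjacent n a b) (edgeW n a b)
edgeW-reflects n a b = edgeW1-reflects n a b ⊎-reflects edgeW1-reflects n b a

edgeW-symmetric : ∀ n a b → edgeW n a b ≡ edgeW n b a
edgeW-symmetric n a b = BoolP.∨-comm (edgeW1 n a b) (edgeW1 n b a)

edge-from-outer : ∀ {n a b} → n < a → Edge n a b → a ≤ n ℕ.+ n × b ≡ suc (n ℕ.+ n)
edge-from-outer n<a (inj₁ (_ , a≤n , _)) = contradiction a≤n (ℕP.<⇒≱ n<a)
edge-from-outer n<a (inj₂ (inj₁ (_ , a≤n , _))) = contradiction a≤n (ℕP.<⇒≱ n<a)
edge-from-outer _ (inj₂ (inj₂ (_ , a≤2n , b≡apex))) = a≤2n , b≡apex

edge-into-outer : ∀ {n a b} → a ≤ n → n < b → Edge n a b → b ≡ a ℕ.+ n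
edge-into-outer a≤n n<b (inj₁ (_ , _ , _ , b≤n , _)) = contradiction b≤n (ℕP.<⇒≱ n<b)
edge-into-outer a≤n n<b (inj₂ (inj₁ (_ , _ , b≡rung))) = b≡rung
edge-into-outer a≤n n<b (inj₂ (inj₂ (n<a , _))) = contradiction a≤n (ℕP.<⇒≱ n<a)

WStarK-irreflexive : ∀ {n} → 1 ≤ n → ∀ i → WStarK n i i ≡ false
WStarK-irreflexive {n} 1≤n i = det (edgeW-reflects n a a) (ofⁿ [ loopless , loopless ])
  where
  a = suc (toℕ i)
  loopless : ¬ Edge n a a
  loopless (inj₁ (_ , _ , _ , _ , a≢a)) = a≢a refl
  loopless (inj₂ (inj₁ (_ , _ , a≡a+n))) = ℕP.<⇒≢ (ℕP.m<m+n a 1≤n) a≡a+n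
  loopless (inj₂ (inj₂ (_ , a≤2n , a≡apex))) = ℕP.n≮n (n ℕ.+ n) (subst (_≤ n ℕ.+ n) a≡apex a≤2n)

WStarK-symmetric : ∀ n i j → WStarK n i j ≡ WStarK n j i
WStarK-symmetric n i j = edgeW-symmetric n (suc (toℕ i)) (suc (toℕ j))

-- Vertices are numbered from 0 here: p < n lies in K_n, and the leg n + p joins p to the apex n + n.
adj : ℕ → ℕ → ℕ → ℤ
adj n p q = boolℤ (edgeW n (suc p) (suc q))

adj-one : ∀ {n p q} → Adjacent n (suc p) (suc q) → adj n p q ≡ + 1
adj-one {n} {p} {q} e = cong boolℤ (det (edgeW-reflects n (suc p) (suc q)) (ofʸ e))

adj-zero : ∀ {n p q} → ¬ Adjacent n (suc p) (suc q) → adj n p q ≡ 0ℤ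
adj-zero {n} {p} {q} ¬e = cong boolℤ (det (edgeW-reflects n (suc p) (suc q)) (ofⁿ ¬e))

adj-symmetric : ∀ n p q → adj n p q ≡ adj n q p
adj-symmetric n p q = cong boolℤ (edgeW-symmetric n (suc p) (suc q))

adj-clique : ∀ {n p q} → p < n → q < n → p ≢ q → adj n p q ≡ + 1
adj-clique p<n q<n p≢q = adj-one (inj₁ (inj₁ (s≤s z≤n , p<n , s≤s z≤n , q<n , p≢q ∘ ℕP.suc-injective)))

adj-rung : ∀ {n q} → q < n → adj n (n ℕ.+ q) q ≡ + 1
adj-rung {n} {q} q<n = adj-one (inj₂ (inj₂ (inj₁ (s≤s z≤n , q<n , cong suc (ℕP.+-comm n q)))))

adj-spoke : ∀ {n t} → t < n → adj n (n ℕ.+ n) (n ℕ.+ t) ≡ + 1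
adj-spoke {n} {t} t<n = adj-one (inj₂ (inj₂ (inj₂ (s≤s (ℕP.m≤m+n n t) , ℕP.+-monoʳ-< n t<n , refl))))

adj-leg-core : ∀ {n r q} → r < n → q < n → r ≢ q → adj n (n ℕ.+ r) q ≡ 0ℤ
adj-leg-core {n} {r} {q} r<n q<n r≢q = adj-zero [ from-leg , into-leg ]
  where
  from-leg : ¬ Edge n (suc (n ℕ.+ r)) (suc q)
  from-leg e with edge-from-outer (s≤s (ℕP.m≤m+n n r)) e
  ... | _ , q≡2n = ℕP.<⇒≱ q<n (subst (n ≤_) (sym (ℕP.suc-injective q≡2n)) (ℕP.m≤m+n n n))
  into-leg : ¬ Edge n (suc q) (suc (n ℕ.+ r))
  into-leg e = r≢q (ℕP.+-cancelˡ-≡ n r q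
    (trans (ℕP.suc-injective (edge-into-outer q<n (s≤s (ℕP.m≤m+n n r)) e)) (ℕP.+-comm q n)))

adj-apex-core : ∀ {n q} → q < n → adj n (n ℕ.+ n) q ≡ 0ℤ
adj-apex-core {n} {q} q<n = adj-zero [ from-apex , into-apex ]
  where
  from-apex : ¬ Edge n (suc (n ℕ.+ n)) (suc q)
  from-apex e = ℕP.n≮n (n ℕ.+ n) (proj₁ (edge-from-outer (s≤s (ℕP.m≤m+n n n)) e))
  into-apex : ¬ Edge n (suc q) (suc (n ℕ.+ n))
  into-apex e = ℕP.<⇒≢ q<n (sym (ℕP.+-cancelʳ-≡ n n q
    (ℕP.suc-injective (edge-into-outer q<n (s≤s (ℕP.m≤m+n n n)) e))))

adj-leg-leg : ∀ {n r s} → r < n → s < n → adj n (n ℕ.+ r) (n ℕ.+ s) ≡ 0ℤ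
adj-leg-leg {n} {r} {s} r<n s<n = adj-zero [ between r s s<n , between s r r<n ]
  where
  between : ∀ r s → s < n → ¬ Edge n (suc (n ℕ.+ r)) (suc (n ℕ.+ s))
  between r s s<n e = ℕP.<⇒≢ s<n
    (ℕP.+-cancelˡ-≡ n s n (ℕP.suc-injective (proj₂ (edge-from-outer (s≤s (ℕP.m≤m+n n r)) e))))

order : ℕ → ℕ
order n = suc (2 ℕ.* n)

2*n≡n+n : ∀ n → 2 ℕ.* n ≡ n ℕ.+ n
2*n≡n+n n = cong (n ℕ.+_) (ℕP.+-identityʳ n)

∑<-regions : ∀ n (f : ℕ → ℤ) →
  ∑< (order n) f ≡ ∑< n f + ∑[ r < n ] f (n ℕ.+ r) + f (n ℕ.+ n)
∑<-regions n f = begin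
  ∑< (order n) f                                 ≡⟨ cong (λ k → ∑< (suc k) f) (2*n≡n+n n) ⟩
  ∑< (suc (n ℕ.+ n)) f                           ≡⟨ ∑<-snoc (n ℕ.+ n) f ⟩
  ∑< (n ℕ.+ n) f + f (n ℕ.+ n)                   ≡⟨ cong (λ s → s + f (n ℕ.+ n)) (∑<-+ n n f) ⟩
  ∑< n f + ∑[ r < n ] f (n ℕ.+ r) + f (n ℕ.+ n)  ∎
  where open ≡-Reasoning

data Label (n : ℕ) : ℕ → Set where
  core : ∀ {q} → q < n → Label n q
  leg  : ∀ {t} → t < n → Label n (n ℕ.+ t)

label : ∀ n {p} → p < 2 ℕ.* n → Label n p
label n {p} p<2n with p ℕ.<? n
... | yes p<n = core p<n
... | no p≮n = subst (Label n) (ℕP.m+[n∸m]≡n n≤p) (leg (ℕP.+-cancelˡ-< n (p ℕ.∸ n) n bound))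
  where
  n≤p = ℕP.≮⇒≥ p≮n
  bound : n ℕ.+ (p ℕ.∸ n) < n ℕ.+ n
  bound = subst₂ _<_ (sym (ℕP.m+[n∸m]≡n n≤p)) (2*n≡n+n n) p<2n

core<2n : ∀ {n q} → q < n → q < 2 ℕ.* n
core<2n {n} {q} q<n = subst (q <_) (sym (2*n≡n+n n)) (ℕP.<-≤-trans q<n (ℕP.m≤m+n n n))

leg<2n : ∀ {n t} → t < n → n ℕ.+ t < 2 ℕ.* n
leg<2n {n} {t} t<n = subst (n ℕ.+ t <_) (sym (2*n≡n+n n)) (ℕP.+-monoʳ-< n t<n)

module _ (n : ℕ) (X : ℕ → ℤ) where

  coreEntry : ℕ → ℤ
  coreEntry q = (+ suc n * X q - ∑< n X) - X (n ℕ.+ q)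

  legEntry : ℕ → ℤ
  legEntry t = (+ 2 * X (n ℕ.+ t) - X t) - X (n ℕ.+ n)

  CoreDivisible : Set
  CoreDivisible = ∀ q → q < n → + order n ∣ coreEntry q

  LegDivisible : Set
  LegDivisible = ∀ t → t < n → + order n ∣ legEntry t

  Lx : ℕ → ℤ
  Lx p = ∑[ r < order n ] ((X p - X r) * adj n r p)

  Lx-core : ∀ {q} → q < n → Lx q ≡ coreEntry q
  Lx-core {q} q<n = begin
    ∑< (order n) h                                   ≡⟨ ∑<-regions n h ⟩
    ∑< n h + ∑[ r < n ] h (n ℕ.+ r) + h (n ℕ.+ n)    ≡⟨ cong₂ _+_ (cong₂ _+_ clique-part rung-part) apex-part ⟩
    (+ n * X q - ∑< n X) + (X q - X (n ℕ.+ q)) + 0ℤ  ≡⟨ collect (+ n) (X q) (∑< n X) (X (n ℕ.+ q)) ⟩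
    coreEntry q                                      ∎
    where
    open ≡-Reasoning
    h : ℕ → ℤ
    h p = (X q - X p) * adj n p q
    clique-term : ∀ p → p < n → h p ≡ X q - X p
    clique-term p p<n with p ℕ.≟ q
    ... | yes refl rewrite ℤP.+-inverseʳ (X q) = ℤP.*-zeroˡ (adj n q q)
    ... | no p≢q = weight-one (X q - X p) (adj-clique p<n q<n p≢q)
    clique-part : ∑< n h ≡ + n * X q - ∑< n X
    clique-part = trans (∑<-cong n clique-term) (∑<-const-sub n (X q) X)
    rung-part : ∑[ r < n ] h (n ℕ.+ r) ≡ X q - X (n ℕ.+ q)
    rung-part = trans (∑<-single n {λ r → h (n ℕ.+ r)} q q<n
                        (λ r r<n r≢q → weight-zero (X q - X (n ℕ.+ r)) (adj-leg-core r<n q<n r≢q)))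
                      (weight-one (X q - X (n ℕ.+ q)) (adj-rung q<n))
    apex-part : h (n ℕ.+ n) ≡ 0ℤ
    apex-part = weight-zero (X q - X (n ℕ.+ n)) (adj-apex-core q<n)
    collect : ∀ N x S y → (N * x - S) + (x - y) + 0ℤ ≡ (+ 1 + N) * x - S - y
    collect = solve-∀

  Lx-leg : ∀ {t} → t < n → Lx (n ℕ.+ t) ≡ legEntry t
  Lx-leg {t} t<n = begin
    ∑< (order n) h                                 ≡⟨ ∑<-regions n h ⟩
    ∑< n h + ∑[ r < n ] h (n ℕ.+ r) + h (n ℕ.+ n)  ≡⟨ cong₂ _+_ (cong₂ _+_ rung-part leg-part) spoke-part ⟩
    (X c - X t) + 0ℤ + (X c - X (n ℕ.+ n))         ≡⟨ collect (X c) (X t) (X (n ℕ.+ n)) ⟩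
    legEntry t                                     ∎
    where
    open ≡-Reasoning
    c = n ℕ.+ t
    h : ℕ → ℤ
    h p = (X c - X p) * adj n p c
    rung-part : ∑< n h ≡ X c - X t
    rung-part = trans (∑<-single n {h} t t<n
                        (λ p p<n p≢t → weight-zero (X c - X p)
                           (trans (adj-symmetric n p c) (adj-leg-core t<n p<n (p≢t ∘ sym)))))
                      (weight-one (X c - X t) (trans (adj-symmetric n t c) (adj-rung t<n)))
    leg-part : ∑[ r < n ] h (n ℕ.+ r) ≡ 0ℤ
    leg-part = ∑<-zero n (λ r r<n → weight-zero (X c - X (n ℕ.+ r)) (adj-leg-leg r<n t<n))
    spoke-part : h (n ℕ.+ n) ≡ X c - X (n ℕ.+ n)
    spoke-part = weight-one (X c - X (n ℕ.+ n)) (adj-spoke t<n)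
    collect : ∀ y x z → (y - x) + 0ℤ + (y - z) ≡ + 2 * y - x - z
    collect = solve-∀

  total-decomposition : ∑< (order n) X
    ≡ + 3 * ∑< n coreEntry + + 2 * ∑< n legEntry + + order n * X (n ℕ.+ n)
  total-decomposition = begin
    ∑< (order n) X  ≡⟨ ∑<-regions n X ⟩
    S + U + z       ≡⟨ combine (+ n) S U z ⟩
    + 3 * (+ suc n * S + ℤ.-1ℤ * U + + n * - S)
      + + 2 * (+ 2 * U + ℤ.-1ℤ * S + + n * - z) + + suc (n ℕ.+ n) * z
      ≡⟨ cong₂ (λ a b → + 3 * a + + 2 * b + + suc (n ℕ.+ n) * z) (sym core-sum) (sym leg-sum) ⟩
    + 3 * ∑< n coreEntry + + 2 * ∑< n legEntry + + suc (n ℕ.+ n) * z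
      ≡⟨ cong (λ k → + 3 * ∑< n coreEntry + + 2 * ∑< n legEntry + + suc k * z) (sym (2*n≡n+n n)) ⟩
    + 3 * ∑< n coreEntry + + 2 * ∑< n legEntry + + order n * z ∎
    where
    open ≡-Reasoning
    S = ∑< n X
    U = ∑[ r < n ] X (n ℕ.+ r)
    z = X (n ℕ.+ n)
    core-sum : ∑< n coreEntry ≡ + suc n * S + ℤ.-1ℤ * U + + n * - S
    core-sum = trans (∑<-cong n (λ q _ → affine (+ suc n) (X q) (X (n ℕ.+ q)) S))
                     (∑<-affine n (+ suc n) ℤ.-1ℤ (- S) X (λ r → X (n ℕ.+ r)))
      where
      affine : ∀ a x y c → (a * x - c) - y ≡ a * x + ℤ.-1ℤ * y + - c
      affine = solve-∀
    leg-sum : ∑< n legEntry ≡ + 2 * U + ℤ.-1ℤ * S + + n * - z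
    leg-sum = trans (∑<-cong n (λ t _ → affine (X (n ℕ.+ t)) (X t) z))
                    (∑<-affine n (+ 2) ℤ.-1ℤ (- z) (λ r → X (n ℕ.+ r)) X)
      where
      affine : ∀ y x c → (+ 2 * y - x) - c ≡ + 2 * y + ℤ.-1ℤ * x + - c
      affine = solve-∀
    combine : ∀ N S U z → S + U + z ≡
      + 3 * ((+ 1 + N) * S + ℤ.-1ℤ * U + N * - S)
        + + 2 * (+ 2 * U + ℤ.-1ℤ * S + N * - z) + (+ 1 + (N + N)) * z
    combine = solve-∀

  total-divisible : CoreDivisible → LegDivisible → + order n ∣ ∑< (order n) X
  total-divisible core∣ leg∣ = subst (+ order n ∣_) (sym total-decomposition)
    (∣m∣n⇒∣m+n (∣m∣n⇒∣m+n (∣n⇒∣m*n (+ 3) (∑<-∣ n core∣)) (∣n⇒∣m*n (+ 2) (∑<-∣ n leg∣)))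
                (∣m⇒∣m*n (X (n ℕ.+ n)) ∣-refl))

  Lx-divisible : CoreDivisible → LegDivisible → ∀ {p} → p < 2 ℕ.* n → + order n ∣ Lx p
  Lx-divisible core∣ leg∣ p<2n = divisible (label n p<2n)
    where
    divisible : ∀ {p} → Label n p → + order n ∣ Lx p
    divisible (core q<n) = subst (+ order n ∣_) (sym (Lx-core q<n)) (core∣ _ q<n)
    divisible (leg t<n) = subst (+ order n ∣_) (sym (Lx-leg t<n)) (leg∣ _ t<n)

-- Lattice points of the Laplacian simplex

module _ (n : ℕ) (x : Fin (order n) → ℤ) where

  private
    X : ℕ → ℤ
    X p = at x (suc p)

  column : Fin (order n) → ℤ
  column c = sum (λ i → x i * liftVertex (WStarK n) i c)

  column-integral⇔ : ∀ c →
    IsInteger (sumℚ (λ i → (x i ℚ./ order n) ℚ.* (liftVertex (WStarK n) i c ℚ./ 1))) ⇔ + order n ∣ column c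
  column-integral⇔ c = subst₂ (λ q w → IsInteger q ⇔ + order n ∣ w)
    (sym (sumℚ-/ (2 ℕ.* n) x (λ i → liftVertex (WStarK n) i c)))
    (sumℤ≡sum (λ i → x i * liftVertex (WStarK n) i c))
    (isInteger-/⇔∣ (sumℤ (λ i → x i * liftVertex (WStarK n) i c)) (2 ℕ.* n))

  column-inner : 1 ≤ n → ∀ c → toℕ c < 2 ℕ.* n → column c ≡ Lx n X (toℕ c)
  column-inner 1≤n c c<2n = begin
    sum (λ i → x i * liftVertex G i c)
      ≡⟨ sum-cong-≗ (λ i → cong (x i *_) (liftVertex-inner G i c c<2n)) ⟩
    sum (λ i → x i * laplacian G i c′)
      ≡⟨ laplacian-action G (WStarK-symmetric n) (WStarK-irreflexive 1≤n) x c′ ⟩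
    sum (λ i → (x c′ - x i) * boolℤ (G i c′))
      ≡⟨ sum-cong-≗ relabel ⟩
    Lx n X (toℕ c)
      ∎
    where
    open ≡-Reasoning
    G = WStarK n
    c′ = inject₁ (fromℕ< c<2n)
    toℕ-c′ : toℕ c′ ≡ toℕ c
    toℕ-c′ = trans (FinP.toℕ-inject₁ (fromℕ< c<2n)) (FinP.toℕ-fromℕ< c<2n)
    relabel : ∀ i →
      (x c′ - x i) * adj n (toℕ i) (toℕ c′) ≡ (X (toℕ c) - X (toℕ i)) * adj n (toℕ i) (toℕ c)
    relabel i = trans
      (cong₂ (λ u v → (u - v) * adj n (toℕ i) (toℕ c′)) (sym (at-suc-toℕ x c′)) (sym (at-suc-toℕ x i)))
      (cong (λ q → (X q - X (toℕ i)) * adj n (toℕ i) q) toℕ-c′)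

  column-last : ∀ c → ¬ toℕ c < 2 ℕ.* n → column c ≡ ∑< (order n) X
  column-last c c≮2n = sum-cong-≗ λ i →
    trans (weight-one (x i) (liftVertex-last (WStarK n) i c c≮2n)) (sym (at-suc-toℕ x i))

  columns-divisible⇔ : 1 ≤ n → (∀ c → + order n ∣ column c) ⇔ (CoreDivisible n X × LegDivisible n X)
  columns-divisible⇔ 1≤n = mk⇔ to from
    where
    Lx∣ : (∀ c → + order n ∣ column c) → ∀ {p} → p < 2 ℕ.* n → + order n ∣ Lx n X p
    Lx∣ column∣ {p} p<2n = subst (+ order n ∣_)
      (trans (column-inner 1≤n c (subst (_< 2 ℕ.* n) (sym toℕ-c) p<2n)) (cong (Lx n X) toℕ-c))
      (column∣ c)
      where
      c = fromℕ< (ℕP.m<n⇒m<1+n p<2n)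
      toℕ-c = FinP.toℕ-fromℕ< (ℕP.m<n⇒m<1+n p<2n)
    to : (∀ c → + order n ∣ column c) → CoreDivisible n X × LegDivisible n X
    to column∣ = (λ q q<n → subst (+ order n ∣_) (Lx-core n X q<n) (Lx∣ column∣ (core<2n q<n)))
               , (λ t t<n → subst (+ order n ∣_) (Lx-leg n X t<n) (Lx∣ column∣ (leg<2n t<n)))
    from : CoreDivisible n X × LegDivisible n X → ∀ c → + order n ∣ column c
    from (core∣ , leg∣) c = by-position (toℕ c ℕ.<? 2 ℕ.* n)
      where
      by-position : Dec (toℕ c < 2 ℕ.* n) → + order n ∣ column c
      by-position (yes c<2n) =
        subst (+ order n ∣_) (sym (column-inner 1≤n c c<2n)) (Lx-divisible n X core∣ leg∣ c<2n)
      by-position (no c≮2n) =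
        subst (+ order n ∣_) (sym (column-last c c≮2n)) (total-divisible n X core∣ leg∣)

  CoreCongruences : Set
  CoreCongruences = (i : ℕ) → suc n ≤ i → i ≤ 2 ℕ.* n →
    Σ ℤ (λ k → at x i ≡ + suc n * at x (i ℕ.∸ n) - sumTo x n - + order n * k)

  LegCongruences : Set
  LegCongruences = (j : ℕ) → 1 ≤ j → j ≤ n →
    Σ ℤ (λ m → at x (suc (2 ℕ.* n)) ≡ + 2 * at x (j ℕ.+ n) - at x j - + order n * m)

  core-congruence⇔ : ∀ q → + order n ∣ coreEntry n X q ⇔
    Σ ℤ (λ k → at x (suc (n ℕ.+ q)) ≡ + suc n * at x (suc (n ℕ.+ q) ℕ.∸ n) - sumTo x n - + order n * k)
  core-congruence⇔ q =
    subst (λ a → + order n ∣ coreEntry n X q ⇔ Σ ℤ (λ k → X (n ℕ.+ q) ≡ a - + order n * k))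
      (cong₂ (λ p s → + suc n * at x p - s) (sym suc[n+q]∸n≡suc[q]) (sym (sumTo≡∑< x n)))
      (∣-sub⇔ (+ order n) (+ suc n * X q - ∑< n X) (X (n ℕ.+ q)))
    where
    suc[n+q]∸n≡suc[q] : suc (n ℕ.+ q) ℕ.∸ n ≡ suc q
    suc[n+q]∸n≡suc[q] = trans (cong (ℕ._∸ n) (sym (ℕP.+-suc n q))) (ℕP.m+n∸m≡n n (suc q))

  leg-congruence⇔ : ∀ t → + order n ∣ legEntry n X t ⇔
    Σ ℤ (λ m → at x (suc (2 ℕ.* n)) ≡ + 2 * at x (suc t ℕ.+ n) - at x (suc t) - + order n * m)
  leg-congruence⇔ t =
    subst₂ (λ y u → + order n ∣ legEntry n X t ⇔ Σ ℤ (λ m → y ≡ + 2 * u - X t - + order n * m))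
      (cong X (sym (2*n≡n+n n))) (cong X (ℕP.+-comm n t))
      (∣-sub⇔ (+ order n) (+ 2 * X (n ℕ.+ t) - X t) (X (n ℕ.+ n)))

  core-congruences⇔ : CoreDivisible n X ⇔ CoreCongruences
  core-congruences⇔ = mk⇔ to from
    where
    to : CoreDivisible n X → CoreCongruences
    to core∣ (suc p) (s≤s n≤p) p<2n with label n p<2n
    ... | core p<n = contradiction n≤p (ℕP.<⇒≱ p<n)
    ... | leg t<n = Equivalence.to (core-congruence⇔ _) (core∣ _ t<n)
    from : CoreCongruences → CoreDivisible n X
    from congruent q q<n = Equivalence.from (core-congruence⇔ q)
      (congruent (suc (n ℕ.+ q)) (s≤s (ℕP.m≤m+n n q)) (leg<2n q<n))

  leg-congruences⇔ : LegDivisible n X ⇔ LegCongruences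
  leg-congruences⇔ = mk⇔ to from
    where
    to : LegDivisible n X → LegCongruences
    to leg∣ (suc t) _ t<n = Equivalence.to (leg-congruence⇔ t) (leg∣ t t<n)
    from : LegCongruences → LegDivisible n X
    from congruent t t<n = Equivalence.from (leg-congruence⇔ t) (congruent (suc t) (s≤s z≤n) t<n)

theorem3p27 : (n : ℕ) → 1 ℕ.≤ n → (x : Fin (suc (2 ℕ.* n)) → ℤ) →
    InΛ (WStarK n) (λ i → x i ℚ./ suc (2 ℕ.* n))
    ⇔ (((i : Fin (suc (2 ℕ.* n))) → (+ 0 ℤ.≤ x i) × (x i ℤ.≤ + (2 ℕ.* n)))
      × ((i : ℕ) → suc n ℕ.≤ i → i ℕ.≤ 2 ℕ.* n →
          Σ ℤ (λ k → at x i ≡ (+ suc n ℤ.* at x (i ℕ.∸ n)) ℤ.- sumTo x n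
                                ℤ.- (+ suc (2 ℕ.* n) ℤ.* k)))
      × ((j : ℕ) → 1 ℕ.≤ j → j ℕ.≤ n →
          Σ ℤ (λ m → at x (suc (2 ℕ.* n)) ≡ (+ 2 ℤ.* at x (j ℕ.+ n)) ℤ.- at x j
                                ℤ.- (+ suc (2 ℕ.* n) ℤ.* m))))
theorem3p27 n 1≤n x =
  Π-⇔ (λ i → 0≤/⇔ (x i) (2 ℕ.* n) ×-⇔ /<1⇔ (x i) (2 ℕ.* n))
  ×-⇔ ((core-congruences⇔ n x ×-⇔ leg-congruences⇔ n x)
       ⇔-∘ (columns-divisible⇔ n x 1≤n ⇔-∘ Π-⇔ (column-integral⇔ n x)))
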